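{- Let $a,b$ be positive integers and let $s_0,s_1,\ldots,s_{a-1}$ be integers with $0\leq s_0\leq s_1\leq\cdots\leq s_{a-1}<b$. If $$\left\lceil\frac{ak}{b}\right\rceil = \sum_{i=0}^{a-1}\left\lfloor\frac{k+s_i}{b}\right\rfloor$$ holds for every nonnegative integer $k$, then $s_i=\lceil (i+1)b/a \rceil-1$ for $i=0,1,\ldots,a-1$. -}

module Defs where

open import Data.Nat using (ℕ; _+_; _∸_; _/_; NonZero)

ceilDiv : (m n : ℕ) → .{{_ : NonZero n}} → ℕ
ceilDiv m n = (m + n ∸ 1) / n

-- Put k = b ∸ m with m ≤ b.  Every summand (k + s j) / b is then 0 or 1, and it is 1 exactly
-- when m ≤ s j, so the hypothesis says that ⌈a(b ∸ m)/b⌉ counts the indices j with s j ≥ m.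
-- Since s is monotone, taking m = s i gives at least a ∸ i such indices and taking
-- m = s i + 1 at most a ∸ (i + 1).  Cleared of the ceiling, these two counts read
-- s i · a < (i + 1) b ≤ (s i + 1) a, which pins down s i + 1 = ⌈(i + 1) b / a⌉.
module Submission where

open import Defs
open import Data.Nat
  using (ℕ; zero; suc; _+_; _*_; _∸_; _/_; _≤_; _<_; _>_; _≰_; NonZero; z≤n; s≤s; z<s; s≤s⁻¹)
open import Data.Fin using (Fin; zero; suc; toℕ)
open import Data.List using (map; allFin; tabulate)
open import Data.Nat.ListAction using (sum)
open import Relation.Binary.PropositionalEquality using (_≡_; sym; trans; cong; module ≡-Reasoning)
open import Data.Nat.Properties
open import Data.Nat.DivMod
open import Data.Fin.Properties using (toℕ<n)
open import Data.List.Properties using (map-tabulate)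
open import Function using (id)

m<[1+m/n]*n : ∀ m n .{{_ : NonZero n}} → m < suc (m / n) * n
m<[1+m/n]*n m n = begin-strict
  m                 ≡⟨ m≡m%n+[m/n]*n m n ⟩
  m % n + m / n * n <⟨ +-monoˡ-< (m / n * n) (m%n<n m n) ⟩
  n + m / n * n     ∎
  where open ≤-Reasoning

ceilDiv-suc : ∀ m n → ceilDiv m (suc n) ≡ (m + n) / suc n
ceilDiv-suc m n = /-congˡ (cong (_∸ 1) (+-suc m n))

ceilDiv≤⇒≤* : ∀ {m o} n .{{_ : NonZero n}} → ceilDiv m n ≤ o → m ≤ o * n
ceilDiv≤⇒≤* {m} {o} (suc n) le = +-cancelʳ-≤ n m (o * suc n) (s≤s⁻¹ (begin-strict
  m + n                       <⟨ m<[1+m/n]*n (m + n) (suc n) ⟩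
  suc ((m + n) / suc n) * suc n ≤⟨ *-monoˡ-≤ (suc n) (s≤s quotient≤o) ⟩
  suc n + o * suc n           ≡⟨ +-comm (suc n) (o * suc n) ⟩
  o * suc n + suc n           ≡⟨ +-suc (o * suc n) n ⟩
  suc (o * suc n + n)         ∎))
  where
  open ≤-Reasoning
  quotient≤o : (m + n) / suc n ≤ o
  quotient≤o = ≤-trans (≤-reflexive (sym (ceilDiv-suc m n))) le

≤*⇒ceilDiv≤ : ∀ {m o} n .{{_ : NonZero n}} → m ≤ o * n → ceilDiv m n ≤ o
≤*⇒ceilDiv≤ {m} {o} (suc n) le = begin
  ceilDiv m (suc n) ≡⟨ ceilDiv-suc m n ⟩
  (m + n) / suc n   ≤⟨ s≤s⁻¹ (m<n*o⇒m/o<n (begin-strict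
                         m + n             ≤⟨ +-monoˡ-≤ n le ⟩
                         o * suc n + n     <⟨ +-monoʳ-< (o * suc n) (n<1+n n) ⟩
                         o * suc n + suc n ≡⟨ +-comm (o * suc n) (suc n) ⟩
                         suc o * suc n     ∎)) ⟩
  o                 ∎
  where open ≤-Reasoning

ceilDiv-unique : ∀ {m o} n .{{_ : NonZero n}} →
                 o * n < m → m ≤ suc o * n → ceilDiv m n ≡ suc o
ceilDiv-unique n lower upper =
  ≤-antisym (≤*⇒ceilDiv≤ n upper) (≰⇒> λ ceil≤o → <⇒≱ lower (ceilDiv≤⇒≤* n ceil≤o))

m≤x⇒[n∸m+x]/n>0 : ∀ {m n x} .{{_ : NonZero n}} → m ≤ n → m ≤ x → (n ∸ m + x) / n > 0
m≤x⇒[n∸m+x]/n>0 {m} {n} {x} m≤n m≤x = m≥n⇒m/n>0 (begin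
  n         ≡⟨ m∸n+n≡m m≤n ⟨
  n ∸ m + m ≤⟨ +-monoʳ-≤ (n ∸ m) m≤x ⟩
  n ∸ m + x ∎)
  where open ≤-Reasoning

x<m⇒[n∸m+x]/n≡0 : ∀ {m n x} .{{_ : NonZero n}} → m ≤ n → x < m → (n ∸ m + x) / n ≡ 0
x<m⇒[n∸m+x]/n≡0 {m} {n} {x} m≤n x<m = m<n⇒m/n≡0 (begin-strict
  n ∸ m + x <⟨ +-monoʳ-< (n ∸ m) x<m ⟩
  n ∸ m + m ≡⟨ m∸n+n≡m m≤n ⟩
  n         ∎)
  where open ≤-Reasoning

m≤n⇒x<n⇒[m+x]/n≤1 : ∀ {m n x} .{{_ : NonZero n}} → m ≤ n → x < n → (m + x) / n ≤ 1
m≤n⇒x<n⇒[m+x]/n≤1 {m} {n} {x} m≤n x<n = s≤s⁻¹ (m<n*o⇒m/o<n (begin-strict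
  m + x     <⟨ +-mono-≤-< m≤n x<n ⟩
  n + n     ≡⟨ cong (n +_) (+-identityʳ n) ⟨
  2 * n     ∎))
  where open ≤-Reasoning

sum-tabulate-≥ : ∀ {n} (g : Fin n → ℕ) i → (∀ j → i ≤ toℕ j → g j > 0) →
                 n ∸ i ≤ sum (tabulate g)
sum-tabulate-≥ {zero}  g i       pos = ≤-reflexive (0∸n≡0 i)
sum-tabulate-≥ {suc n} g zero    pos =
  +-mono-≤ (pos zero z≤n) (sum-tabulate-≥ (λ j → g (suc j)) zero λ j _ → pos (suc j) z≤n)
sum-tabulate-≥ {suc n} g (suc i) pos =
  ≤-trans (sum-tabulate-≥ (λ j → g (suc j)) i λ j i≤j → pos (suc j) (s≤s i≤j)) (m≤n+m _ (g zero))

sum-tabulate-≤ : ∀ {n} (g : Fin n → ℕ) i → (∀ j → g j ≤ 1) → (∀ j → toℕ j < i → g j ≡ 0) →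
                 sum (tabulate g) ≤ n ∸ i
sum-tabulate-≤ {zero}  g i       ≤1 zeros = z≤n
sum-tabulate-≤ {suc n} g zero    ≤1 zeros =
  +-mono-≤ (≤1 zero) (sum-tabulate-≤ (λ j → g (suc j)) zero (λ j → ≤1 (suc j)) λ _ ())
sum-tabulate-≤ {suc n} g (suc i) ≤1 zeros rewrite zeros zero z<s =
  sum-tabulate-≤ (λ j → g (suc j)) i (λ j → ≤1 (suc j)) λ j j<i → zeros (suc j) (s≤s j<i)

split-product : ∀ {a b m p} → m ≤ b → p ≤ a → m * a + a * (b ∸ m) ≡ p * b + (a ∸ p) * b
split-product {a} {b} {m} {p} m≤b p≤a = begin
  m * a + a * (b ∸ m)   ≡⟨ cong (m * a +_) (*-comm a (b ∸ m)) ⟩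
  m * a + (b ∸ m) * a   ≡⟨ *-distribʳ-+ a m (b ∸ m) ⟨
  (m + (b ∸ m)) * a     ≡⟨ cong (_* a) (m+[n∸m]≡n m≤b) ⟩
  b * a                 ≡⟨ *-comm b a ⟩
  a * b                 ≡⟨ cong (_* b) (m+[n∸m]≡n p≤a) ⟨
  (p + (a ∸ p)) * b     ≡⟨ *-distribʳ-+ b p (a ∸ p) ⟩
  p * b + (a ∸ p) * b   ∎
  where open ≡-Reasoning

+-balance-< : ∀ {x y z w} → x + y ≡ z + w → w < y → x < z
+-balance-< {x} {y} {z} {w} eq w<y =
  +-cancelʳ-< w x z (≤-trans (+-monoʳ-< x w<y) (≤-reflexive eq))

+-balance-≤ : ∀ {x y z w} → x + y ≡ z + w → w ≤ y → x ≤ z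
+-balance-≤ {x} {y} {z} {w} eq w≤y =
  +-cancelʳ-≤ w x z (≤-trans (+-monoʳ-≤ x w≤y) (≤-reflexive eq))

module _ {a b : ℕ} .{{_ : NonZero a}} .{{_ : NonZero b}} {s : Fin a → ℕ}
  (mono : ∀ i j → i Data.Fin.≤ j → s i Data.Nat.≤ s j)
  (bnd : ∀ i → s i < b)
  (hyp : ∀ k → ceilDiv (a * k) b ≡ sum (map (λ i → (k + s i) / b) (allFin a)))
  where

  ceilDiv≡sum : ∀ k → ceilDiv (a * k) b ≡ sum (tabulate (λ j → (k + s j) / b))
  ceilDiv≡sum k = trans (hyp k) (cong sum (map-tabulate id (λ j → (k + s j) / b)))

  s*a<[1+i]*b : ∀ i → s i * a < suc (toℕ i) * b
  s*a<[1+i]*b i = +-balance-< (split-product s≤b p≤a) (≰⇒> a*k≰q*b)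
    where
    p≤a : suc (toℕ i) ≤ a
    p≤a = toℕ<n i
    s≤b : s i ≤ b
    s≤b = <⇒≤ (bnd i)
    k : ℕ
    k = b ∸ s i
    many : a ∸ toℕ i ≤ ceilDiv (a * k) b
    many = ≤-trans (sum-tabulate-≥ _ (toℕ i) λ j i≤j → m≤x⇒[n∸m+x]/n>0 s≤b (mono i j i≤j))
                   (≤-reflexive (sym (ceilDiv≡sum k)))
    a*k≰q*b : a * k ≰ (a ∸ suc (toℕ i)) * b
    a*k≰q*b ak≤qb =
      <⇒≱ (∸-monoʳ-< (n<1+n (toℕ i)) p≤a) (≤-trans many (≤*⇒ceilDiv≤ b ak≤qb))

  [1+i]*b≤[1+s]*a : ∀ i → suc (toℕ i) * b ≤ suc (s i) * a
  [1+i]*b≤[1+s]*a i =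
    +-balance-≤ (sym (split-product (bnd i) (toℕ<n i))) (ceilDiv≤⇒≤* b few)
    where
    k : ℕ
    k = b ∸ suc (s i)
    few : ceilDiv (a * k) b ≤ a ∸ suc (toℕ i)
    few = ≤-trans (≤-reflexive (ceilDiv≡sum k))
                  (sum-tabulate-≤ _ (suc (toℕ i))
                     (λ j → m≤n⇒x<n⇒[m+x]/n≤1 (m∸n≤m b (suc (s i))) (bnd j))
                     λ j j≤i → x<m⇒[n∸m+x]/n≡0 (bnd i) (s≤s (mono j i (s≤s⁻¹ j≤i))))

corollary2p2 : (a b : ℕ) → .{{_ : NonZero a}} → .{{_ : NonZero b}} → (s : Fin a → ℕ)
    → (∀ (i j : Fin a) → i Data.Fin.≤ j → s i Data.Nat.≤ s j)
    → (∀ (i : Fin a) → s i < b)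
    → (∀ (k : ℕ) → ceilDiv (a * k) b ≡ sum (map (λ i → (k + s i) / b) (allFin a)))
    → ∀ (i : Fin a) → s i ≡ ceilDiv (suc (toℕ i) * b) a ∸ 1
corollary2p2 a b s mono bnd hyp i = cong (_∸ 1) (sym (ceilDiv-unique a lower upper))
  where
  lower : s i * a < suc (toℕ i) * b
  lower = s*a<[1+i]*b mono bnd hyp i
  upper : suc (toℕ i) * b ≤ suc (s i) * a
  upper = [1+i]*b≤[1+s]*a mono bnd hyp i
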